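{- Let $\Sigma$ be a finite alphabet and let $I \subset P \subset \Sigma\times\Sigma\times\Sigma$ be a promise problem which is an injection problem. Then the deterministic communication complexity of $(I,P)$ equals $\lceil \log_2 \chi(I,P) \rceil$.
   Context: A promise problem over a finite alphabet $\Sigma$ is a pair $I \subset P \subset \Sigma^3$: three players receive $a,b,c\in\Sigma$ respectively, with the promise $(a,b,c)\in P$, and must decide whether $(a,b,c)\in I$. Deterministic communication uses a shared blackboard: players act in cyclic order, and at each stage a player (as a function of its own input and the current blackboard) either appends bits to the blackboard, accepts, or rejects; an input is accepted iff all players accept. A protocol solves $(I,P)$ if it accepts every input of $I$ and rejects every input of $P\setminus I$ (no requirement outside $P$). The deterministic communication complexity $\mathrm{cc}(I,P)$ is the minimum, over protocols solving $(I,P)$, of the maximum number of bits written. Let $\pi_1,\pi_2,\pi_3:\Sigma^3\to\Sigma$ be the coordinate projections. $(I,P)$ is an injection problem if for every $a\in\Sigma$ there is at most one pair $(b,c)$ with $(a,b,c)\in I$, and similarly for the second and third coordinates. A set $S\subset\Sigma^3$ is a permutation of an identity tensor if each element of $\pi_1(S)$ (resp. $\pi_2(S)$, $\pi_3(S)$) occurs in exactly one triple of $S$. A subset $S\subset I$ is independent (in $(I,P)$) if $S$ is a permutation of an identity tensor and $P\cap(\pi_1(S)\times\pi_2(S)\times\pi_3(S)) = S$. A proper coloring is a map $\tau: I\to[k]$ all of whose color classes $\tau^{ -1}(c)$ are independent, and the chromatic number $\chi(I,P)$ is the least $k$ admitting a proper coloring $\tau:I\to[k]$. -}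

module Defs where

open import Data.Nat using (ℕ; zero; suc; _≤_; _⊔_)
open import Data.Fin using (Fin; zero; suc)
open import Data.Bool using (Bool; true; false; if_then_else_; _∧_)
open import Data.Product using (Σ; ∃; _×_; _,_; proj₁; proj₂)
open import Relation.Nullary using (¬_)
open import Relation.Unary using (Pred; _⊆_; Decidable)
open import Relation.Binary.PropositionalEquality using (_≡_)
open import Level using (0ℓ)

Triple : ℕ → Set
Triple n = Fin n × Fin n × Fin n

π : ∀ {n} → Fin 3 → Triple n → Fin n
π zero                (a , b , c) = a
π (suc zero)          (a , b , c) = b
π (suc (suc zero))    (a , b , c) = c

TSet : ℕ → Set₁
TSet n = Pred (Triple n) 0ℓ

IsInjection : ∀ {n} → TSet n → Set
IsInjection {n} I = ∀ (i : Fin 3) (s t : Triple n) → I s → I t → π i s ≡ π i t → s ≡ t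

InProj : ∀ {n} → TSet n → Fin 3 → Fin n → Set
InProj {n} S i x = ∃ λ (s : Triple n) → S s × π i s ≡ x

-- S is a permutation of an identity tensor: every element of π_i(S)
-- occurs in exactly one triple of S.
IsPermId : ∀ {n} → TSet n → Set
IsPermId {n} S = ∀ (i : Fin 3) (s t : Triple n) → S s → S t → π i s ≡ π i t → s ≡ t

InBox : ∀ {n} → TSet n → Triple n → Set
InBox S t = InProj S zero (π zero t) × InProj S (suc zero) (π (suc zero) t)
          × InProj S (suc (suc zero)) (π (suc (suc zero)) t)

IsIndependent : ∀ {n} → TSet n → TSet n → TSet n → Set
IsIndependent {n} I P S =
  S ⊆ I × IsPermId S
  × (∀ (t : Triple n) → (P t × InBox S t) → S t)
  × (∀ (t : Triple n) → S t → (P t × InBox S t))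

-- colour class τ⁻¹(c) of a colouring τ of I (τ is only relevant on I)
ColourClass : ∀ {n k} → TSet n → (Triple n → Fin k) → Fin k → TSet n
ColourClass I τ c t = I t × τ t ≡ c

IsProperColouring : ∀ {n k} → TSet n → TSet n → (Triple n → Fin k) → Set
IsProperColouring {k = k} I P τ = ∀ (c : Fin k) → IsIndependent I P (ColourClass I τ c)

IsChromaticNumber : ∀ {n} → TSet n → TSet n → ℕ → Set
IsChromaticNumber {n} I P k =
  (Σ (Triple n → Fin k) λ τ → IsProperColouring I P τ)
  × (∀ (m : ℕ) (τ : Triple n → Fin m) → IsProperColouring I P τ → k ≤ m)

-- Deterministic 3-party (number-in-hand, shared blackboard) protocols,
-- as protocol trees: at an internal node the owning player i writes one
-- bit on the blackboard, computed from its own input; at a leaf (the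
-- communication has ended) every player accepts or rejects as a function
-- of its own input (and the blackboard, i.e. the leaf).

data Protocol (n : ℕ) : Set where
  leaf : (Fin 3 → Fin n → Bool) → Protocol n
  node : Fin 3 → (Fin n → Bool) → Protocol n → Protocol n → Protocol n

run : ∀ {n} → Protocol n → Triple n → Bool
run (leaf acc) t = acc zero (π zero t) ∧ acc (suc zero) (π (suc zero) t)
                   ∧ acc (suc (suc zero)) (π (suc (suc zero)) t)
run (node i f p₀ p₁) t = if f (π i t) then run p₁ t else run p₀ t

cost : ∀ {n} → Protocol n → ℕ
cost (leaf _) = zero
cost (node _ _ p₀ p₁) = suc (cost p₀ ⊔ cost p₁)

Solves : ∀ {n} → Protocol n → TSet n → TSet n → Set
Solves {n} p I P = ∀ (t : Triple n) → P t →
  (I t → run p t ≡ true) × (¬ I t → run p t ≡ false)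

IsCommComplexity : ∀ {n} → TSet n → TSet n → ℕ → Set
IsCommComplexity {n} I P c =
  (Σ (Protocol n) λ p → Solves p I P × cost p ≤ c)
  × (∀ (p : Protocol n) → Solves p I P → c ≤ cost p)

-- The inputs reaching a given leaf of a protocol tree form a combinatorial rectangle,
-- and so do the inputs accepted there. Hence, if inputs of I reaching one leaf span a
-- box, every promise input in that box reaches the same leaf, is accepted, and so lies
-- in I: colouring I by leaves (at most 2 ^ cost of them) is proper, and
-- ⌈log₂ χ⌉ ≤ cc. Conversely, since (I , P) is an injection problem, the first player
-- knows the unique triple of I through its input; it announces that triple's colour in
-- ⌈log₂ χ⌉ bits and each player accepts iff its coordinate lies in the projection of
-- that colour class. An accepted promise input then lies in the box of an independent
-- class, hence in the class. Finally χ exists because colourings may be taken to depend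
-- on the first coordinate only, which makes colourability a finite search.

module Submission where

open import Defs
open import Data.Nat using (ℕ; zero; suc; _+_; _*_; _∸_; _^_; _≤_; _<_; z≤n; s≤s; ⌈_/2⌉; _≤ᵇ_)
open import Data.Nat.Properties
open import Data.Nat.Induction using (<-rec; <-wellFounded)
open import Data.Nat.Logarithm using (⌈log₂_⌉; ⌈log₂2^n⌉≡n; ⌈log₂⌉-mono-≤)
open import Data.Nat.Logarithm.Core using (⌈log2⌉)
open import Induction.WellFounded using (Acc; acc)
open import Data.Fin using (Fin; zero; suc; toℕ; fromℕ<; finToFun; funToFin)
open import Data.Fin.Properties
  using (any?; all?; toℕ-fromℕ<; toℕ-injective; toℕ<n; finToFun-funToFin)
  renaming (_≟_ to _≟ᶠ_)
open import Data.Product using (Σ; ∃; _×_; _,_; proj₁; proj₂)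
open import Data.Bool using (Bool; true; false; _∧_)
open import Data.Bool.Properties using (∧-conicalˡ; ∧-conicalʳ; ¬-not; T-≡)
open import Data.Empty using (⊥-elim)
open import Function using (_∘_; id)
open import Function.Bundles using (_⇔_; mk⇔; Equivalence)
open import Level using (Level)
open import Relation.Nullary using (¬_; Dec; yes; no)
open import Relation.Nullary.Reflects using (ofʸ; ofⁿ)
open import Relation.Nullary.Decidable using (map′; _×-dec_; _→-dec_; isYes; toWitness; fromWitness)
open import Relation.Unary using (Pred; _⊆_; Decidable)
open import Relation.Binary.PropositionalEquality

open Equivalence using (to; from)

module _ {n : ℕ} {ℓ : Level} {Q : Pred (Triple n) ℓ} (Q? : Decidable Q) where

  any-triple? : Dec (∃ Q)
  any-triple? = map′ (λ (a , b , c , q) → (a , b , c) , q) (λ ((a , b , c) , q) → a , b , c , q)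
    (any? λ a → any? λ b → any? λ c → Q? (a , b , c))

  all-triple? : Dec (∀ t → Q t)
  all-triple? = map′ (λ h (a , b , c) → h a b c) (λ h a b c → h (a , b , c))
    (all? λ a → all? λ b → all? λ c → Q? (a , b , c))

any-function? : ∀ {m k ℓ} {Q : Pred (Fin m → Fin k) ℓ} →
  (∀ {f g} → f ≗ g → Q f → Q g) → Decidable Q → Dec (∃ Q)
any-function? resp Q? = map′ (λ (i , q) → finToFun i , q)
  (λ (f , q) → funToFin f , resp (λ x → sym (finToFun-funToFin f x)) q)
  (any? (Q? ∘ finToFun))

least-satisfying : ∀ {ℓ} {Q : Pred ℕ ℓ} → Decidable Q →
  ∀ m → Q m → ∃ λ k → Q k × (∀ j → j < k → ¬ Q j)
least-satisfying {Q = Q} Q? = <-rec _ step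
  where
  step : ∀ m → (∀ {j} → j < m → Q j → ∃ λ k → Q k × (∀ j → j < k → ¬ Q j)) →
         Q m → ∃ λ k → Q k × (∀ j → j < k → ¬ Q j)
  step m smaller qm with anyUpTo? Q? m
  ... | yes (j , j<m , qj) = smaller j<m qj
  ... | no none = m , qm , λ j j<m qj → none (j , j<m , qj)

n≤2*⌈n/2⌉ : ∀ n → n ≤ 2 * ⌈ n /2⌉
n≤2*⌈n/2⌉ zero = z≤n
n≤2*⌈n/2⌉ (suc zero) = s≤s z≤n
n≤2*⌈n/2⌉ (suc (suc n)) =
  subst (suc (suc n) ≤_) (sym (*-suc 2 ⌈ n /2⌉)) (s≤s (s≤s (n≤2*⌈n/2⌉ n)))

n≤2^⌈log₂n⌉ : ∀ n → n ≤ 2 ^ ⌈log₂ n ⌉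
n≤2^⌈log₂n⌉ n = bound n (<-wellFounded n)
  where
  bound : ∀ n (a : Acc _<_ n) → n ≤ 2 ^ ⌈log2⌉ n a
  bound zero _ = z≤n
  bound (suc zero) _ = s≤s z≤n
  bound (suc (suc m)) (acc smaller) =
    ≤-trans (n≤2*⌈n/2⌉ (suc (suc m))) (*-monoʳ-≤ 2 (bound (suc ⌈ m /2⌉) _))

π-ext : ∀ {n} {x y : Triple n} → (∀ i → π i x ≡ π i y) → x ≡ y
π-ext {x = _ , _ , _} {_ , _ , _} h =
  cong₂ _,_ (h zero) (cong₂ _,_ (h (suc zero)) (h (suc (suc zero))))

module _ {n : ℕ} {S : TSet n} where

  InBox⇔ : ∀ {t} → InBox S t ⇔
    (∃ λ (s : Fin 3 → Triple n) → (∀ i → S (s i)) × (∀ i → π i (s i) ≡ π i t))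
  InBox⇔ = mk⇔
    (λ ((s₀ , S₀ , e₀) , (s₁ , S₁ , e₁) , (s₂ , S₂ , e₂)) →
       (λ { zero → s₀ ; (suc zero) → s₁ ; (suc (suc zero)) → s₂ })
     , (λ { zero → S₀ ; (suc zero) → S₁ ; (suc (suc zero)) → S₂ })
     , (λ { zero → e₀ ; (suc zero) → e₁ ; (suc (suc zero)) → e₂ }))
    (λ (s , s∈S , agree) → (s zero , s∈S zero , agree zero)
                          , (s (suc zero) , s∈S (suc zero) , agree (suc zero))
                          , (s (suc (suc zero)) , s∈S (suc (suc zero)) , agree (suc (suc zero))))

  InBox-member : ∀ {t} → S t → InBox S t
  InBox-member {t} st = from InBox⇔ ((λ _ → t) , (λ _ → st) , (λ _ → refl))

  InProj? : Decidable S → ∀ i → Decidable (InProj S i)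
  InProj? S? i x = any-triple? (λ s → S? s ×-dec (π i s ≟ᶠ x))

  InBox? : Decidable S → Decidable (InBox S)
  InBox? S? t = InProj? S? zero (π zero t)
    ×-dec InProj? S? (suc zero) (π (suc zero) t)
    ×-dec InProj? S? (suc (suc zero)) (π (suc (suc zero)) t)

InBox-mono : ∀ {n} {S S′ : TSet n} {t} → S ⊆ S′ → InBox S t → InBox S′ t
InBox-mono S⊆S′ box =
  let (s , s∈S , agree) = to InBox⇔ box in from InBox⇔ (s , S⊆S′ ∘ s∈S , agree)

accepted-leaf : ∀ {n} (accept : Fin 3 → Fin n → Bool) (x : Triple n) →
  run (leaf accept) x ≡ true ⇔ (∀ j → accept j (π j x) ≡ true)
accepted-leaf accept (a , b , c) = mk⇔
  (λ r → λ { zero → ∧-conicalˡ x (y ∧ z) r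
           ; (suc zero) → ∧-conicalˡ y z (∧-conicalʳ x (y ∧ z) r)
           ; (suc (suc zero)) → ∧-conicalʳ y z (∧-conicalʳ x (y ∧ z) r) })
  (λ h → cong₂ _∧_ (h zero) (cong₂ _∧_ (h (suc zero)) (h (suc (suc zero)))))
  where
  x = accept zero a
  y = accept (suc zero) b
  z = accept (suc (suc zero)) c

leaf-rectangle : ∀ {n} (accept : Fin 3 → Fin n → Bool) (s : Fin 3 → Triple n) t →
  (∀ i → π i (s i) ≡ π i t) → (∀ i → run (leaf accept) (s i) ≡ true) →
  run (leaf accept) t ≡ true
leaf-rectangle accept s t agree accepted = from (accepted-leaf accept t) λ j →
  trans (cong (accept j) (sym (agree j))) (to (accepted-leaf accept (s j)) (accepted j) j)

data Leaf {n : ℕ} : Protocol n → Set where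
  here  : ∀ {accept} → Leaf (leaf accept)
  left  : ∀ {i f p₀ p₁} → Leaf p₀ → Leaf (node i f p₀ p₁)
  right : ∀ {i f p₀ p₁} → Leaf p₁ → Leaf (node i f p₀ p₁)

module _ {n : ℕ} where

  reach : (p : Protocol n) → Triple n → Leaf p
  reach (leaf _) t = here
  reach (node i f p₀ p₁) t with f (π i t)
  ... | false = left (reach p₀ t)
  ... | true  = right (reach p₁ t)

  accepts : ∀ {p : Protocol n} → Leaf p → Fin 3 → Fin n → Bool
  accepts {leaf accept} here = accept
  accepts (left l) = accepts l
  accepts (right l) = accepts l

  run-reach : ∀ p t → run p t ≡ run (leaf (accepts (reach p t))) t
  run-reach (leaf _) t = refl
  run-reach (node i f p₀ p₁) t with f (π i t)
  ... | false = run-reach p₀ t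
  ... | true  = run-reach p₁ t

  reach≡left⇔ : ∀ {i f p₀ p₁ t} {l : Leaf p₀} →
    reach (node i f p₀ p₁) t ≡ left l ⇔ (f (π i t) ≡ false × reach p₀ t ≡ l)
  reach≡left⇔ {i} {f} {t = t} = mk⇔ ⇒ ⇐
    where
    ⇒ : ∀ {l} → reach (node i f _ _) t ≡ left l → f (π i t) ≡ false × reach _ t ≡ l
    ⇒ eq with f (π i t)
    ⇒ refl | false = refl , refl
    ⇒ ()   | true
    ⇐ : ∀ {l} → f (π i t) ≡ false × reach _ t ≡ l → reach (node i f _ _) t ≡ left l
    ⇐ (eq , refl) rewrite eq = refl

  reach≡right⇔ : ∀ {i f p₀ p₁ t} {l : Leaf p₁} →
    reach (node i f p₀ p₁) t ≡ right l ⇔ (f (π i t) ≡ true × reach p₁ t ≡ l)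
  reach≡right⇔ {i} {f} {t = t} = mk⇔ ⇒ ⇐
    where
    ⇒ : ∀ {l} → reach (node i f _ _) t ≡ right l → f (π i t) ≡ true × reach _ t ≡ l
    ⇒ eq with f (π i t)
    ⇒ refl | true = refl , refl
    ⇒ ()   | false
    ⇐ : ∀ {l} → f (π i t) ≡ true × reach _ t ≡ l → reach (node i f _ _) t ≡ right l
    ⇐ (eq , refl) rewrite eq = refl

  reach-rectangle : ∀ p (s : Fin 3 → Triple n) t {l : Leaf p} →
    (∀ i → π i (s i) ≡ π i t) → (∀ i → reach p (s i) ≡ l) → reach p t ≡ l
  reach-rectangle (leaf _) s t {here} agree same = refl
  reach-rectangle (node i f p₀ p₁) s t {left l} agree same = from reach≡left⇔
    ( trans (cong f (sym (agree i))) (proj₁ (to reach≡left⇔ (same i)))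
    , reach-rectangle p₀ s t agree (λ j → proj₂ (to reach≡left⇔ (same j))) )
  reach-rectangle (node i f p₀ p₁) s t {right l} agree same = from reach≡right⇔
    ( trans (cong f (sym (agree i))) (proj₁ (to reach≡right⇔ (same i)))
    , reach-rectangle p₁ s t agree (λ j → proj₂ (to reach≡right⇔ (same j))) )

  rectangle : ∀ p (s : Fin 3 → Triple n) t {l : Leaf p} →
    (∀ i → π i (s i) ≡ π i t) → (∀ i → reach p (s i) ≡ l) → (∀ i → run p (s i) ≡ true) →
    reach p t ≡ l × run p t ≡ true
  rectangle p s t {l} agree same accepted = reach-t , (begin
    run p t                           ≡⟨ run-reach p t ⟩
    run (leaf (accepts (reach p t))) t ≡⟨ cong (λ l′ → run (leaf (accepts l′)) t) reach-t ⟩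
    run (leaf (accepts l)) t          ≡⟨ leaf-rectangle (accepts l) s t agree accepted-at-l ⟩
    true                              ∎)
    where
    open ≡-Reasoning
    reach-t : reach p t ≡ l
    reach-t = reach-rectangle p s t agree same
    accepted-at-l : ∀ i → run (leaf (accepts l)) (s i) ≡ true
    accepted-at-l i = trans (cong (λ l′ → run (leaf (accepts l′)) (s i)) (sym (same i)))
                            (trans (sym (run-reach p (s i))) (accepted i))

leafCode : ∀ {n} {p : Protocol n} → Leaf p → ℕ
leafCode here = 0
leafCode (left l) = 2 * leafCode l
leafCode (right l) = suc (2 * leafCode l)

leafCode-injective : ∀ {n} {p : Protocol n} (l l′ : Leaf p) →
  leafCode l ≡ leafCode l′ → l ≡ l′
leafCode-injective here here _ = refl
leafCode-injective (left l) (left l′) eq =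
  cong left (leafCode-injective l l′ (*-cancelˡ-≡ (leafCode l) (leafCode l′) 2 eq))
leafCode-injective (right l) (right l′) eq =
  cong right (leafCode-injective l l′ (*-cancelˡ-≡ (leafCode l) (leafCode l′) 2 (suc-injective eq)))
leafCode-injective (left l) (right l′) eq = ⊥-elim (even≢odd (leafCode l) (leafCode l′) eq)
leafCode-injective (right l) (left l′) eq = ⊥-elim (even≢odd (leafCode l′) (leafCode l) (sym eq))

1+2*m<2*n : ∀ {m n} → m < n → suc (2 * m) < 2 * n
1+2*m<2*n {m} {n} m<n = subst (_≤ 2 * n) (*-suc 2 m) (*-monoʳ-≤ 2 m<n)

leafCode< : ∀ {n} {p : Protocol n} (l : Leaf p) → leafCode l < 2 ^ cost p
leafCode< here = s≤s z≤n
leafCode< {p = node _ _ p₀ p₁} (left l) = ≤-trans (n≤1+n _)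
  (1+2*m<2*n (<-≤-trans (leafCode< l) (^-monoʳ-≤ 2 (m≤m⊔n (cost p₀) (cost p₁)))))
leafCode< {p = node _ _ p₀ p₁} (right l) =
  1+2*m<2*n (<-≤-trans (leafCode< l) (^-monoʳ-≤ 2 (m≤n⊔m (cost p₀) (cost p₁))))

module _ {n : ℕ} where

  leafIndex : ∀ {p : Protocol n} → Leaf p → Fin (2 ^ cost p)
  leafIndex l = fromℕ< (leafCode< l)

  leafIndex-injective : ∀ {p : Protocol n} {l l′ : Leaf p} →
    leafIndex l ≡ leafIndex l′ → l ≡ l′
  leafIndex-injective {l = l} {l′} eq = leafCode-injective l l′ (begin
    leafCode l             ≡⟨ toℕ-fromℕ< (leafCode< l) ⟨
    toℕ (leafIndex l)      ≡⟨ cong toℕ eq ⟩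
    toℕ (leafIndex l′)     ≡⟨ toℕ-fromℕ< (leafCode< l′) ⟩
    leafCode l′            ∎)
    where open ≡-Reasoning

  announce : Fin 3 → ℕ → (Fin n → ℕ) → (ℕ → Protocol n) → Protocol n
  announce i zero g k = k 0
  announce i (suc L) g k = node i (λ x → 2 ^ L ≤ᵇ g x)
    (announce i L g k)
    (announce i L (λ x → g x ∸ 2 ^ L) (λ v → k (2 ^ L + v)))

  run-announce : ∀ i L g k t → g (π i t) < 2 ^ L →
    run (announce i L g k) t ≡ run (k (g (π i t))) t
  run-announce i zero g k t g<1 = cong (λ v → run (k v) t) (sym (n<1⇒n≡0 g<1))
  run-announce i (suc L) g k t g<2^L+2^L
    with 2 ^ L ≤ᵇ g (π i t) | ≤ᵇ-reflects-≤ (2 ^ L) (g (π i t))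
  ... | false | ofⁿ 2^L≰g = run-announce i L g k t (≰⇒> 2^L≰g)
  ... | true  | ofʸ 2^L≤g = begin
    run (announce i L (λ x → g x ∸ 2 ^ L) (λ v → k (2 ^ L + v))) t
      ≡⟨ run-announce i L _ _ t low-bits< ⟩
    run (k (2 ^ L + (g (π i t) ∸ 2 ^ L))) t
      ≡⟨ cong (λ v → run (k v) t) (m+[n∸m]≡n 2^L≤g) ⟩
    run (k (g (π i t))) t ∎
    where
    open ≡-Reasoning
    low-bits< : g (π i t) ∸ 2 ^ L < 2 ^ L
    low-bits< = m<n+o⇒m∸n<o (g (π i t)) (2 ^ L) {{m^n≢0 2 L}}
      (subst (g (π i t) <_) (cong (2 ^ L +_) (+-identityʳ (2 ^ L))) g<2^L+2^L)

  cost-announce : ∀ i L g k {c} → (∀ v → cost (k v) ≤ c) → cost (announce i L g k) ≤ L + c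
  cost-announce i zero g k bounded = bounded 0
  cost-announce i (suc L) g k bounded = s≤s (⊔-lub
    (cost-announce i L g k bounded)
    (cost-announce i L _ _ (λ v → bounded (2 ^ L + v))))

solves-by : ∀ {n} (p : Protocol n) {I P : TSet n} →
  (∀ {t} → P t → I t → run p t ≡ true) → (∀ {t} → P t → run p t ≡ true → I t) →
  Solves p I P
solves-by p complete sound t pt = complete pt , λ ¬it → ¬-not (¬it ∘ sound pt)

accepted⇒member : ∀ {n} {p : Protocol n} {I P : TSet n} → Decidable I → Solves p I P →
  ∀ {t} → P t → run p t ≡ true → I t
accepted⇒member I? solves {t} pt accepted with I? t
... | yes it = it
... | no ¬it with () ← trans (sym accepted) (proj₂ (solves t pt) ¬it)

module InjectionProblem {n : ℕ} (I P : TSet n) (I? : Decidable I) (P? : Decidable P)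
                        (I⊆P : I ⊆ P) (inj : IsInjection I) where

  Proper : ∀ {k} → (Triple n → Fin k) → Set
  Proper = IsProperColouring I P

  ClassClosed : ∀ {k} → (Triple n → Fin k) → Fin k → Set
  ClassClosed τ c = ∀ t → P t × InBox (ColourClass I τ c) t → ColourClass I τ c t

  closed⇒proper : ∀ {k} {τ : Triple n → Fin k} → (∀ c → ClassClosed τ c) → Proper τ
  closed⇒proper closed c = proj₁
    , (λ i s t cs ct → inj i s t (proj₁ cs) (proj₁ ct))
    , closed c
    , (λ t ct → I⊆P (proj₁ ct) , InBox-member ct)

  proper⇒closed : ∀ {k} {τ : Triple n → Fin k} → Proper τ → ∀ c → ClassClosed τ c
  proper⇒closed proper c = proj₁ (proj₂ (proj₂ (proper c)))

  class? : ∀ {k} (τ : Triple n → Fin k) c → Decidable (ColourClass I τ c)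
  class? τ c t = I? t ×-dec (τ t ≟ᶠ c)

  proper? : ∀ {k} (τ : Triple n → Fin k) → Dec (Proper τ)
  proper? τ = map′ closed⇒proper proper⇒closed (all? λ c →
    all-triple? λ t → (P? t ×-dec InBox? (class? τ c) t) →-dec class? τ c t)

  proper-resp : ∀ {k} {τ τ′ : Triple n → Fin k} →
    (∀ {t} → I t → τ t ≡ τ′ t) → Proper τ → Proper τ′
  proper-resp {τ = τ} {τ′} τ≗τ′ proper = closed⇒proper λ c t (pt , box) →
    let (it , τt≡c) = proper⇒closed proper c t
                        (pt , InBox-mono (λ (is , e) → is , trans (τ≗τ′ is) e) box)
    in it , trans (sym (τ≗τ′ it)) τt≡c

  injective⇒proper : ∀ {k} {τ : Triple n → Fin k} →
    (∀ {s s′} → I s → I s′ → τ s ≡ τ s′ → s ≡ s′) → Proper τ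
  injective⇒proper {τ = τ} τ-inj = closed⇒proper λ c t (_ , box) →
    let (s , s∈class , agree) = to InBox⇔ box
        same : ∀ i → s i ≡ s zero
        same i = τ-inj (proj₁ (s∈class i)) (proj₁ (s∈class zero))
                       (trans (proj₂ (s∈class i)) (sym (proj₂ (s∈class zero))))
        s₀≡t : s zero ≡ t
        s₀≡t = π-ext λ i → trans (cong (π i) (sym (same i))) (agree i)
    in subst (ColourClass I τ c) s₀≡t (s∈class zero)

  Colourable : ℕ → Set
  Colourable k = ∃ λ (σ : Fin n → Fin k) → Proper (σ ∘ π zero)

  colourable? : Decidable Colourable
  colourable? k = any-function? (λ σ≗σ′ → proper-resp (λ {t} _ → σ≗σ′ (π zero t)))
                                (λ σ → proper? (σ ∘ π zero))

  colourable-by-first-coordinate : Colourable n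
  colourable-by-first-coordinate = id , injective⇒proper (inj zero _ _)

  withFirstCoordinate? : ∀ a → Dec (∃ λ s → I s × π zero s ≡ a)
  withFirstCoordinate? a = any-triple? (λ s → I? s ×-dec (π zero s ≟ᶠ a))

  -- The default (a , a , a) is irrelevant: properness depends on a colouring only on I.
  representative : Fin n → Triple n
  representative a with withFirstCoordinate? a
  ... | yes (s , _) = s
  ... | no _ = a , a , a

  representative-π₁ : ∀ {t} → I t → representative (π zero t) ≡ t
  representative-π₁ {t} it with withFirstCoordinate? (π zero t)
  ... | yes (s , is , e) = inj zero s t is it e
  ... | no none = ⊥-elim (none (t , it , refl))

  proper⇒colourable : ∀ {m} {τ : Triple n → Fin m} → Proper τ → Colourable m
  proper⇒colourable {τ = τ} proper =
    τ ∘ representative , proper-resp (λ it → cong τ (sym (representative-π₁ it))) proper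

  leafColouring-proper : ∀ (p : Protocol n) → Solves p I P → Proper (leafIndex ∘ reach p)
  leafColouring-proper p solves = closed⇒proper λ c t (pt , box) →
    let (s , s∈class , agree) = to InBox⇔ box
        same : ∀ i → reach p (s i) ≡ reach p (s zero)
        same i = leafIndex-injective (trans (proj₂ (s∈class i)) (sym (proj₂ (s∈class zero))))
        (reach-t , accepted-t) = rectangle p s t agree same
          (λ i → proj₁ (solves (s i) (I⊆P (proj₁ (s∈class i)))) (proj₁ (s∈class i)))
    in accepted⇒member {p = p} I? solves pt accepted-t
     , trans (cong leafIndex reach-t) (proj₂ (s∈class zero))

  module ColourAnnouncement {k} (σ : Fin n → Fin k) (proper : Proper (σ ∘ π zero)) where

    colourOf : Triple n → ℕ
    colourOf s = toℕ (σ (π zero s))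

    HasColour : ℕ → TSet n
    HasColour v s = I s × colourOf s ≡ v

    inColourProjection : ℕ → Fin 3 → Fin n → Bool
    inColourProjection v j x = isYes (InProj? (λ s → I? s ×-dec (colourOf s ≟ v)) j x)

    classLeaf : ℕ → Protocol n
    classLeaf v = leaf (inColourProjection v)

    classLeaf-accepts : ∀ v t →
      run (classLeaf v) t ≡ true ⇔ (∀ j → InProj (HasColour v) j (π j t))
    classLeaf-accepts v t = mk⇔
      (λ r j → toWitness (from T-≡ (to (accepted-leaf (inColourProjection v) t) r j)))
      (λ h → from (accepted-leaf (inColourProjection v) t) λ j → to T-≡ (fromWitness (h j)))

    protocol : Protocol n
    protocol = announce zero ⌈log₂ k ⌉ (toℕ ∘ σ) classLeaf

    cost-protocol : cost protocol ≤ ⌈log₂ k ⌉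
    cost-protocol = subst (cost protocol ≤_) (+-identityʳ _)
      (cost-announce zero ⌈log₂ k ⌉ (toℕ ∘ σ) classLeaf (λ _ → z≤n))

    run-protocol : ∀ t → run protocol t ≡ run (classLeaf (colourOf t)) t
    run-protocol t = run-announce zero ⌈log₂ k ⌉ (toℕ ∘ σ) classLeaf t
      (<-≤-trans (toℕ<n (σ (π zero t))) (n≤2^⌈log₂n⌉ k))

    solves-protocol : Solves protocol I P
    solves-protocol = solves-by protocol complete sound
      where
      complete : ∀ {t} → P t → I t → run protocol t ≡ true
      complete {t} _ it = trans (run-protocol t)
        (from (classLeaf-accepts (colourOf t) t) λ j → t , (it , refl) , refl)
      sound : ∀ {t} → P t → run protocol t ≡ true → I t
      sound {t} pt accepted =
        let w = to (classLeaf-accepts (colourOf t) t) (trans (sym (run-protocol t)) accepted)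
        in proj₁ (proper⇒closed proper (σ (π zero t)) t
             (pt , InBox-mono (λ (is , e) → is , toℕ-injective e)
                              (w zero , w (suc zero) , w (suc (suc zero)))))

  chromaticNumber : ∃ (IsChromaticNumber I P)
  chromaticNumber =
    let (χ , (σ , proper) , below-χ) = least-satisfying colourable? n colourable-by-first-coordinate
    in χ , (σ ∘ π zero , proper)
         , λ m τ proper-τ → ≮⇒≥ λ m<χ → below-χ m m<χ (proper⇒colourable proper-τ)

  commComplexity : ∀ {χ} → IsChromaticNumber I P χ → IsCommComplexity I P ⌈log₂ χ ⌉
  commComplexity {χ} ((_ , proper) , minimal) =
    (protocol , solves-protocol , cost-protocol) , lower-bound
    where
    open ColourAnnouncement (proj₁ (proper⇒colourable proper)) (proj₂ (proper⇒colourable proper))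
    lower-bound : ∀ p → Solves p I P → ⌈log₂ χ ⌉ ≤ cost p
    lower-bound p solves = subst (⌈log₂ χ ⌉ ≤_) (⌈log₂2^n⌉≡n (cost p))
      (⌈log₂⌉-mono-≤ (minimal _ _ (leafColouring-proper p solves)))

mainTheorem1 : (n : ℕ) (I P : TSet n) → Decidable I → Decidable P →
    I ⊆ P → IsInjection I →
    Σ ℕ (λ χ → IsChromaticNumber I P χ × IsCommComplexity I P ⌈log₂ χ ⌉)
mainTheorem1 n I P I? P? I⊆P inj =
  let (χ , isChromatic) = chromaticNumber in χ , isChromatic , commComplexity isChromatic
  where open InjectionProblem I P I? P? I⊆P inj
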